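{- Let $n\ge 3$ be an integer, let $G=L(Cr(n))$, let $A$ be its adjacency matrix and let $A_3$ be its distance-$3$ matrix (entry $1$ in position $(u,v)$ if $d(u,v)=3$, and $0$ otherwise). Let $m=n(n-1)$ be the number of vertices of $G$ and $k=m/2$. Then $AA_3=A_3A$, and the spectrum of $A_3$ consists of the eigenvalue $1$ with multiplicity $k$ and the eigenvalue $-1$ with multiplicity $k$.
   Context: The crown graph $Cr(n)$ is obtained from the complete bipartite graph $K_{n,n}$ by removing a perfect matching. Up to isomorphism, its line graph $L(Cr(n))$ is the graph whose vertex set is $\{(i,j): i,j\in\{1,\dots,n\},\ i\ne j\}$, where two distinct vertices $(i,j)$ and $(r,s)$ are adjacent if and only if $i=r$ or $j=s$. $d(u,v)$ denotes the graph distance in $G$. -}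

module Defs where

open import Data.Bool using (Bool; true; false; _∧_; _∨_; not; if_then_else_)
open import Data.Nat as ℕ using (ℕ; zero; suc; _∸_)
open import Data.Integer as ℤ using (ℤ; +_; -_)
open import Data.Fin as Fin using (Fin; zero; suc; toℕ; remQuot; punchIn)
open import Data.Fin.Properties using () renaming (_≟_ to _≟ᶠ_)
open import Data.Product using (_×_; _,_)
open import Data.List using (List; []; _∷_; map)
open import Relation.Nullary.Decidable using (⌊_⌋)
open import Relation.Binary.PropositionalEquality using (_≡_)

Matrix : ℕ → Set
Matrix m = Fin m → Fin m → ℤ

sumFin : ∀ {m} → (Fin m → ℤ) → ℤ
sumFin {zero}  f = + 0
sumFin {suc m} f = f zero ℤ.+ sumFin (λ i → f (suc i))

_⊗_ : ∀ {m} → Matrix m → Matrix m → Matrix m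
(M ⊗ N) i j = sumFin (λ l → M i l ℤ.* N l j)

-- Polynomials over ℤ: lists of coefficients, lowest degree first

Poly : Set
Poly = List ℤ

_+P_ : Poly → Poly → Poly
[] +P q = q
(a ∷ p) +P [] = a ∷ p
(a ∷ p) +P (b ∷ q) = (a ℤ.+ b) ∷ (p +P q)

scaleP : ℤ → Poly → Poly
scaleP a p = map (a ℤ.*_) p

_*P_ : Poly → Poly → Poly
[] *P q = []
(a ∷ p) *P q = scaleP a q +P (+ 0 ∷ (p *P q))

constP : ℤ → Poly
constP a = a ∷ []

X : Poly
X = + 0 ∷ + 1 ∷ []

_^P_ : Poly → ℕ → Poly
p ^P zero = constP (+ 1)
p ^P suc k = p *P (p ^P k)

coeff : Poly → ℕ → ℤ
coeff [] i = + 0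
coeff (a ∷ p) zero = a
coeff (a ∷ p) (suc i) = coeff p i

-- equality of polynomials (coefficientwise, ignoring trailing zeros)
_≈P_ : Poly → Poly → Set
p ≈P q = ∀ i → coeff p i ≡ coeff q i

sumFinP : ∀ {m} → (Fin m → Poly) → Poly
sumFinP {zero}  f = []
sumFinP {suc m} f = f zero +P sumFinP (λ i → f (suc i))

signP : ∀ {m} → Fin m → Poly
signP j = constP (ℤ.-1ℤ ℤ.^ toℕ j)

det : ∀ {m} → (Fin m → Fin m → Poly) → Poly
det {zero}  M = constP (+ 1)
det {suc m} M =
  sumFinP (λ j → signP j *P (M zero j *P det (λ r c → M (suc r) (punchIn j c))))

charPoly : ∀ {m} → Matrix m → Poly
charPoly M = det (λ i j → (if ⌊ i ≟ᶠ j ⌋ then X else []) +P constP (- M i j))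

anyFin : ∀ {m} → (Fin m → Bool) → Bool
anyFin {zero}  f = false
anyFin {suc m} f = f zero ∨ anyFin (λ i → f (suc i))

walk : ∀ {m} → (Fin m → Fin m → Bool) → ℕ → Fin m → Fin m → Bool
walk adj zero u v = ⌊ u ≟ᶠ v ⌋
walk adj (suc k) u v = anyFin (λ w → adj u w ∧ walk adj k w v)

walkBelow : ∀ {m} → (Fin m → Fin m → Bool) → ℕ → Fin m → Fin m → Bool
walkBelow adj zero u v = false
walkBelow adj (suc k) u v = walk adj k u v ∨ walkBelow adj k u v

distIs : ∀ {m} → (Fin m → Fin m → Bool) → ℕ → Fin m → Fin m → Bool
distIs adj k u v = walk adj k u v ∧ not (walkBelow adj k u v)

boolℤ : Bool → ℤ
boolℤ true = + 1
boolℤ false = + 0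

adjMatrix : ∀ {m} → (Fin m → Fin m → Bool) → Matrix m
adjMatrix adj u v = boolℤ (adj u v)

distMatrix : ∀ {m} → (Fin m → Fin m → Bool) → ℕ → Matrix m
distMatrix adj k u v = boolℤ (distIs adj k u v)

-- The line graph of the crown graph, L(Cr(n)).
-- Vertices: pairs (i,j) ∈ Fin n × Fin n with i ≠ j, enumerated by
-- Fin (n * (n ∸ 1)) via x ↦ (i , punchIn i j') where (i , j') = remQuot x.

numV : ℕ → ℕ
numV n = n ℕ.* (n ∸ 1)

vertex : (n : ℕ) → Fin (numV n) → Fin n × Fin n
vertex zero ()
vertex (suc n) x with remQuot {suc n} n x
... | i , j' = i , punchIn i j'

adjLCr : (n : ℕ) → Fin (numV n) → Fin (numV n) → Bool
adjLCr n u v with vertex n u | vertex n v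
... | i , j | r , s = not ⌊ u ≟ᶠ v ⌋ ∧ (⌊ i ≟ᶠ r ⌋ ∨ ⌊ j ≟ᶠ s ⌋)

{-# OPTIONS --safe #-}
module Submission where

-- Two vertices (i,j), (r,s) are joined by a walk of length ≤ 2 through (i,s) or (r,j) unless
-- (r,s) = (j,i), and (i,j) – (i,k) – (j,k) – (j,i) with k ∉ {i,j} has length 3. So A₃ is the
-- permutation matrix of the fixed-point-free involution σ(i,j) = (j,i). Then (A A₃)(u,v) = A(u,σv)
-- and (A₃ A)(u,v) = A(σu,v), which agree because transposing both endpoints preserves adjacency.
-- Expanding det(xI − A₃) along its first row, every pair {r, σr} contributes (x − 1)(x + 1); the
-- factor x − 1 is attached to the smaller index of the pair, so each factor occurs m/2 times.

open import Algebra.Bundles using (CommutativeMonoid; CommutativeRing)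
import Algebra.Properties.AbelianGroup as AbelianGroupProperties
import Algebra.Properties.CommutativeMonoid.Sum as CommutativeMonoidSum
import Algebra.Properties.CommutativeSemigroup as CommutativeSemigroupProperties
import Algebra.Properties.Ring as RingProperties
import Algebra.Solver.Ring as RingSolver
open import Algebra.Solver.Ring.AlmostCommutativeRing
  using (AlmostCommutativeRing; _-Raw-AlmostCommutative⟶_; fromCommutativeRing)
open import Data.Bool using (Bool; true; false; if_then_else_; not; _∧_; _∨_; T)
open import Data.Bool.Properties using (T-∧; T-∨; T-not-≡; ∨-comm; ∧-zeroʳ)
open import Data.Fin
  using (Fin; zero; suc; inject₁; punchIn; punchOut; combine; remQuot; _<?_)
open import Data.Fin.Induction using (<-weakInduction)
open import Data.Fin.Permutation using (permutation)
open import Data.Fin.Properties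
  using (suc-injective; toℕ-inject₁; punchInᵢ≢i; punchIn-injective; punchIn-punchOut;
         remQuot-combine; combine-remQuot; <-cmp)
  renaming (_≟_ to _≟ᶠ_)
open import Data.Integer as ℤ using (ℤ; +_; -_)
import Data.Integer.Properties as ℤ
open import Data.List using ([]; _∷_)
open import Data.Maybe using (Maybe; just; nothing; maybe)
open import Data.Maybe.Properties using (just-injective)
open import Data.Nat using (ℕ; zero; suc; _≤_; _<_; _+_; _*_; _∸_; s≤s; z≤n)
open import Data.Nat.DivMod using (_/_; m*n/n≡m)
import Data.Nat.Properties as ℕ
open import Data.Product using (_×_; _,_; ∃; proj₁; proj₂; uncurry)
open import Data.Sum as Sum using (_⊎_; inj₁; inj₂)
open import Data.Vec.Functional using (Vector; removeAt; replicate; updateAt)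
open import Data.Vec.Functional.Properties using (updateAt-updates; updateAt-minimal)
open import Function using (_∘_)
open import Function.Bundles using (Equivalence)
open import Relation.Binary.Bundles using (Setoid)
open import Relation.Binary.Definitions using (tri<; tri≈; tri>)
open import Relation.Binary.PropositionalEquality as ≡
  using (_≡_; _≢_; refl; cong; cong₂; ≡-≟-identity; ≢-≟-identity)
open import Relation.Nullary using (Dec; yes; no; does)
open import Relation.Nullary.Decidable
  using (⌊_⌋; T?; dec-true; dec-false; isYes≗does; toWitness; fromWitness)
open import Relation.Nullary.Negation using (¬_; contradiction)

open import Defs

module _ {a ℓ} (M : CommutativeMonoid a ℓ) where
  open CommutativeMonoid M
  open CommutativeMonoidSum M using (sum; sum-remove; sum-cong-≋; sum-replicate-zero)
  open import Relation.Binary.Reasoning.Setoid setoid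

  sum-pick : ∀ {n} (t : Vector Carrier n) i → (∀ j → j ≢ i → t j ≈ ε) → sum t ≈ t i
  sum-pick {suc n} t i others-ε = begin
    sum t                      ≈⟨ sum-remove t ⟩
    t i ∙ sum (removeAt t i)   ≈⟨ ∙-congˡ (sum-cong-≋ {x = removeAt t i} {y = replicate n ε} others-ε′) ⟩
    t i ∙ sum (replicate n ε)  ≈⟨ ∙-congˡ (sum-replicate-zero n) ⟩
    t i ∙ ε                    ≈⟨ identityʳ (t i) ⟩
    t i                        ∎
    where
    others-ε′ : ∀ j → t (punchIn i j) ≈ ε
    others-ε′ j = others-ε (punchIn i j) (punchInᵢ≢i i j)

⌊≟⌋-≡ : ∀ {m} {a b : Fin m} → a ≡ b → ⌊ a ≟ᶠ b ⌋ ≡ true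
⌊≟⌋-≡ a≡b = cong ⌊_⌋ (≡-≟-identity _≟ᶠ_ a≡b)

⌊≟⌋-≢ : ∀ {m} {a b : Fin m} → a ≢ b → ⌊ a ≟ᶠ b ⌋ ≡ false
⌊≟⌋-≢ a≢b = cong ⌊_⌋ (≢-≟-identity _≟ᶠ_ a≢b)

third-index : ∀ {k} {i j : Fin (suc (suc (suc k)))} → i ≢ j → ∃ λ c → c ≢ i × c ≢ j
third-index {k} {i} {j} i≢j = punchIn i c′ , punchInᵢ≢i i c′ , c≢j
  where
  j′ c′ : Fin (suc (suc k))
  j′ = punchOut i≢j
  c′ = punchIn j′ zero
  c≢j : punchIn i c′ ≢ j
  c≢j c≡j = punchInᵢ≢i j′ zero
    (punchIn-injective i c′ j′ (≡.trans c≡j (≡.sym (punchIn-punchOut i≢j))))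

-- Permutation matrices

sumFin≡sum : ∀ {m} (f : Fin m → ℤ) → sumFin f ≡ CommutativeMonoidSum.sum ℤ.+-0-commutativeMonoid f
sumFin≡sum {zero}  f = refl
sumFin≡sum {suc m} f = cong (λ x → f zero ℤ.+ x) (sumFin≡sum (f ∘ suc))

sumFin-pick : ∀ {m} (f : Fin m → ℤ) i → (∀ j → j ≢ i → f j ≡ + 0) → sumFin f ≡ f i
sumFin-pick f i others-zero =
  ≡.trans (sumFin≡sum f) (sum-pick ℤ.+-0-commutativeMonoid f i others-zero)

permutationMatrix : ∀ {m} → (Fin m → Fin m) → Matrix m
permutationMatrix σ r c = boolℤ ⌊ σ r ≟ᶠ c ⌋

module _ {m} (σ : Fin m → Fin m) (P : Matrix m) (P≡ : ∀ r c → P r c ≡ permutationMatrix σ r c) where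
  open ≡.≡-Reasoning

  ⊗-permutationMatrixˡ : ∀ (A : Matrix m) u v → (P ⊗ A) u v ≡ A (σ u) v
  ⊗-permutationMatrixˡ A u v = begin
    sumFin (λ l → P u l ℤ.* A l v)  ≡⟨ sumFin-pick (λ l → P u l ℤ.* A l v) (σ u) others-vanish ⟩
    P u (σ u) ℤ.* A (σ u) v         ≡⟨ cong (ℤ._* A (σ u) v) P-hit ⟩
    + 1 ℤ.* A (σ u) v               ≡⟨ ℤ.*-identityˡ (A (σ u) v) ⟩
    A (σ u) v                       ∎
    where
    P-hit : P u (σ u) ≡ + 1
    P-hit = ≡.trans (P≡ u (σ u)) (cong boolℤ (⌊≟⌋-≡ refl))
    others-vanish : ∀ l → l ≢ σ u → P u l ℤ.* A l v ≡ + 0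
    others-vanish l l≢σu = cong (ℤ._* A l v) (≡.trans (P≡ u l) (cong boolℤ (⌊≟⌋-≢ (l≢σu ∘ ≡.sym))))

  ⊗-permutationMatrixʳ : (∀ r → σ (σ r) ≡ r) → ∀ (A : Matrix m) u v → (A ⊗ P) u v ≡ A u (σ v)
  ⊗-permutationMatrixʳ σ-involutive A u v = begin
    sumFin (λ l → A u l ℤ.* P l v)  ≡⟨ sumFin-pick (λ l → A u l ℤ.* P l v) (σ v) others-vanish ⟩
    A u (σ v) ℤ.* P (σ v) v         ≡⟨ cong (A u (σ v) ℤ.*_) P-hit ⟩
    A u (σ v) ℤ.* + 1               ≡⟨ ℤ.*-identityʳ (A u (σ v)) ⟩
    A u (σ v)                       ∎
    where
    P-hit : P (σ v) v ≡ + 1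
    P-hit = ≡.trans (P≡ (σ v) v) (cong boolℤ (⌊≟⌋-≡ (σ-involutive v)))
    σl≢v : ∀ {l} → l ≢ σ v → σ l ≢ v
    σl≢v {l} l≢σv σl≡v = l≢σv (≡.trans (≡.sym (σ-involutive l)) (cong σ σl≡v))
    others-vanish : ∀ l → l ≢ σ v → A u l ℤ.* P l v ≡ + 0
    others-vanish l l≢σv = ≡.trans
      (cong (A u l ℤ.*_) (≡.trans (P≡ l v) (cong boolℤ (⌊≟⌋-≢ (σl≢v l≢σv)))))
      (ℤ.*-zeroʳ (A u l))

-- Walks and distances

anyFin⁺ : ∀ {m} (f : Fin m → Bool) i → T (f i) → T (anyFin f)
anyFin⁺ f zero    fi = Equivalence.from T-∨ (inj₁ fi)
anyFin⁺ f (suc i) fi = Equivalence.from T-∨ (inj₂ (anyFin⁺ (f ∘ suc) i fi))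

anyFin⁻ : ∀ {m} (f : Fin m → Bool) → T (anyFin f) → ∃ λ i → T (f i)
anyFin⁻ {suc m} f any with Equivalence.to T-∨ any
... | inj₁ f0   = zero , f0
... | inj₂ rest with i , fi ← anyFin⁻ (f ∘ suc) rest = suc i , fi

module _ {m} (adj : Fin m → Fin m → Bool) where

  walk-suc⁺ : ∀ k u w v → T (adj u w) → T (walk adj k w v) → T (walk adj (suc k) u v)
  walk-suc⁺ k u w v uw wv =
    anyFin⁺ (λ x → adj u x ∧ walk adj k x v) w (Equivalence.from (T-∧ {adj u w}) (uw , wv))

  walk-suc⁻ : ∀ k u v → T (walk adj (suc k) u v) → ∃ λ w → T (adj u w) × T (walk adj k w v)
  walk-suc⁻ k u v uv with w , uwv ← anyFin⁻ (λ x → adj u x ∧ walk adj k x v) uv =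
    w , Equivalence.to (T-∧ {adj u w}) uwv

  walk-zero⁺ : ∀ u v → u ≡ v → T (walk adj 0 u v)
  walk-zero⁺ u v = fromWitness {a? = u ≟ᶠ v}

  walk-zero⁻ : ∀ u v → T (walk adj 0 u v) → u ≡ v
  walk-zero⁻ u v = toWitness {a? = u ≟ᶠ v}

  walk-one : ∀ u v → T (adj u v) → T (walk adj 1 u v)
  walk-one u v uv = walk-suc⁺ 0 u v v uv (walk-zero⁺ v v refl)

  walk-two : ∀ u w v → T (adj u w) → T (adj w v) → T (walk adj 2 u v)
  walk-two u w v uw wv = walk-suc⁺ 1 u w v uw (walk-one w v wv)

  walkBelow⁺ : ∀ k l u v → l < k → T (walk adj l u v) → T (walkBelow adj k u v)
  walkBelow⁺ (suc k) l u v l<1+k uv with ℕ.m<1+n⇒m<n∨m≡n l<1+k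
  ... | inj₁ l<k  = Equivalence.from (T-∨ {walk adj k u v}) (inj₂ (walkBelow⁺ k l u v l<k uv))
  ... | inj₂ refl = Equivalence.from (T-∨ {walk adj k u v}) (inj₁ uv)

  walkBelow⁻ : ∀ k u v → T (walkBelow adj k u v) → ∃ λ l → l < k × T (walk adj l u v)
  walkBelow⁻ (suc k) u v uv with Equivalence.to (T-∨ {walk adj k u v}) uv
  ... | inj₁ walk-k = k , ℕ.n<1+n k , walk-k
  ... | inj₂ below with l , l<k , walk-l ← walkBelow⁻ k u v below = l , ℕ.m<n⇒m<1+n l<k , walk-l

  distIs-≡-true : ∀ k u v → T (walk adj k u v) → ¬ T (walkBelow adj k u v) → distIs adj k u v ≡ true
  distIs-≡-true k u v walk-k ¬below = dec-true (T? (distIs adj k u v))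
    (Equivalence.from (T-∧ {walk adj k u v}) (walk-k , Equivalence.from T-not-≡ (dec-false (T? _) ¬below)))

  distIs-≡-false : ∀ k u v → T (walkBelow adj k u v) → distIs adj k u v ≡ false
  distIs-≡-false k u v below = ≡.trans
    (cong (λ b → walk adj k u v ∧ not b) (dec-true (T? (walkBelow adj k u v)) below))
    (∧-zeroʳ (walk adj k u v))

-- The line graph of the crown graph

module LineCrown (n : ℕ) where
  open ≡.≡-Reasoning

  N : ℕ
  N = suc n

  V : Set
  V = Fin (numV N)

  adj : V → V → Bool
  adj = adjLCr N

  code : Fin N × Fin n → Fin N × Fin N
  code (i , j) = i , punchIn i j

  vertex≡code : ∀ u → vertex N u ≡ code (remQuot n u)
  vertex≡code u with remQuot {N} n u
  ... | i , j = refl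

  code-injective : ∀ {p q} → code p ≡ code q → p ≡ q
  code-injective {i , j} {_ , j′} eq with refl ← cong proj₁ eq =
    cong (i ,_) (punchIn-injective i j j′ (cong proj₂ eq))

  row col : V → Fin N
  row u = proj₁ (vertex N u)
  col u = proj₂ (vertex N u)

  row≢col : ∀ u → row u ≢ col u
  row≢col u = ≡.subst (λ p → proj₁ p ≢ proj₂ p) (≡.sym (vertex≡code u)) (punchInᵢ≢i _ _ ∘ ≡.sym)

  vertexAt : ∀ {i j} → i ≢ j → V
  vertexAt {i} i≢j = combine {N} {n} i (punchOut i≢j)

  vertex-vertexAt : ∀ {i j} (i≢j : i ≢ j) → vertex N (vertexAt i≢j) ≡ (i , j)
  vertex-vertexAt {i} {j} i≢j = begin
    vertex N (vertexAt i≢j)              ≡⟨ vertex≡code (vertexAt i≢j) ⟩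
    code (remQuot {N} n (vertexAt i≢j))  ≡⟨ cong code (remQuot-combine {N} {n} i (punchOut i≢j)) ⟩
    (i , punchIn i (punchOut i≢j))       ≡⟨ cong (i ,_) (punchIn-punchOut i≢j) ⟩
    (i , j)                              ∎

  vertex-injective : ∀ {u v} → vertex N u ≡ vertex N v → u ≡ v
  vertex-injective {u} {v} eq = begin
    u                                  ≡⟨ combine-remQuot {N} n u ⟨
    uncurry combine (remQuot {N} n u)  ≡⟨ cong (uncurry combine) (code-injective code-eq) ⟩
    uncurry combine (remQuot {N} n v)  ≡⟨ combine-remQuot {N} n v ⟩
    v                                  ∎
    where
    code-eq : code (remQuot {N} n u) ≡ code (remQuot {N} n v)
    code-eq = ≡.trans (≡.sym (vertex≡code u)) (≡.trans eq (vertex≡code v))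

  row-vertexAt : ∀ {i j} (i≢j : i ≢ j) → row (vertexAt i≢j) ≡ i
  row-vertexAt i≢j = cong proj₁ (vertex-vertexAt i≢j)

  col-vertexAt : ∀ {i j} (i≢j : i ≢ j) → col (vertexAt i≢j) ≡ j
  col-vertexAt i≢j = cong proj₂ (vertex-vertexAt i≢j)

  transpose : V → V
  transpose u = vertexAt (row≢col u ∘ ≡.sym)

  row-transpose : ∀ u → row (transpose u) ≡ col u
  row-transpose u = row-vertexAt (row≢col u ∘ ≡.sym)

  col-transpose : ∀ u → col (transpose u) ≡ row u
  col-transpose u = col-vertexAt (row≢col u ∘ ≡.sym)

  transpose-involutive : ∀ u → transpose (transpose u) ≡ u
  transpose-involutive u = vertex-injective (cong₂ _,_
    (≡.trans (row-transpose (transpose u)) (col-transpose u))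
    (≡.trans (col-transpose (transpose u)) (row-transpose u)))

  transpose-fixpointFree : ∀ u → transpose u ≢ u
  transpose-fixpointFree u σu≡u = row≢col u (≡.trans (≡.sym (cong row σu≡u)) (row-transpose u))

  ⌊≟⌋-transpose : ∀ u v → ⌊ u ≟ᶠ transpose v ⌋ ≡ ⌊ transpose u ≟ᶠ v ⌋
  ⌊≟⌋-transpose u v with u ≟ᶠ transpose v
  ... | yes refl = ≡.sym (⌊≟⌋-≡ (transpose-involutive v))
  ... | no u≢σv  = ≡.sym (⌊≟⌋-≢ λ σu≡v →
    u≢σv (≡.trans (≡.sym (transpose-involutive u)) (cong transpose σu≡v)))

  adj-row-col : ∀ u v → adj u v ≡ not ⌊ u ≟ᶠ v ⌋ ∧ (⌊ row u ≟ᶠ row v ⌋ ∨ ⌊ col u ≟ᶠ col v ⌋)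
  adj-row-col u v with vertex N u | vertex N v
  ... | _ | _ = refl

  adj-transpose : ∀ u v → adj u (transpose v) ≡ adj (transpose u) v
  adj-transpose u v = begin
    adj u (transpose v)
      ≡⟨ adj-row-col u (transpose v) ⟩
    not ⌊ u ≟ᶠ transpose v ⌋ ∧ (⌊ row u ≟ᶠ row (transpose v) ⌋ ∨ ⌊ col u ≟ᶠ col (transpose v) ⌋)
      ≡⟨ cong₂ (λ i j → not ⌊ u ≟ᶠ transpose v ⌋ ∧ (⌊ row u ≟ᶠ i ⌋ ∨ ⌊ col u ≟ᶠ j ⌋))
               (row-transpose v) (col-transpose v) ⟩
    not ⌊ u ≟ᶠ transpose v ⌋ ∧ (⌊ row u ≟ᶠ col v ⌋ ∨ ⌊ col u ≟ᶠ row v ⌋)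
      ≡⟨ cong₂ (λ b c → not b ∧ c) (⌊≟⌋-transpose u v) (∨-comm ⌊ row u ≟ᶠ col v ⌋ _) ⟩
    not ⌊ transpose u ≟ᶠ v ⌋ ∧ (⌊ col u ≟ᶠ row v ⌋ ∨ ⌊ row u ≟ᶠ col v ⌋)
      ≡⟨ cong₂ (λ i j → not ⌊ transpose u ≟ᶠ v ⌋ ∧ (⌊ i ≟ᶠ row v ⌋ ∨ ⌊ j ≟ᶠ col v ⌋))
               (row-transpose u) (col-transpose u) ⟨
    not ⌊ transpose u ≟ᶠ v ⌋ ∧ (⌊ row (transpose u) ≟ᶠ row v ⌋ ∨ ⌊ col (transpose u) ≟ᶠ col v ⌋)
      ≡⟨ adj-row-col (transpose u) v ⟨
    adj (transpose u) v
      ∎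

  Linked : V → V → Set
  Linked u v = row u ≡ row v ⊎ col u ≡ col v

  adj⁺ : ∀ {u v} → u ≢ v → Linked u v → T (adj u v)
  adj⁺ {u} {v} u≢v linked rewrite adj-row-col u v | ⌊≟⌋-≢ u≢v =
    Equivalence.from (T-∨ {⌊ row u ≟ᶠ row v ⌋} {⌊ col u ≟ᶠ col v ⌋})
      (Sum.map (fromWitness {a? = row u ≟ᶠ row v}) (fromWitness {a? = col u ≟ᶠ col v}) linked)

  adj⁻ : ∀ {u v} → T (adj u v) → Linked u v
  adj⁻ {u} {v} uv = Sum.map (toWitness {a? = row u ≟ᶠ row v}) (toWitness {a? = col u ≟ᶠ col v})
    (Equivalence.to T-∨ (proj₂ (Equivalence.to (T-∧ {not ⌊ u ≟ᶠ v ⌋}) (≡.subst T (adj-row-col u v) uv))))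

  ¬Linked-transpose : ∀ u → ¬ Linked u (transpose u)
  ¬Linked-transpose u (inj₁ same-row) = row≢col u (≡.trans same-row (row-transpose u))
  ¬Linked-transpose u (inj₂ same-col) = row≢col u (≡.sym (≡.trans same-col (col-transpose u)))

  ¬Linked-via : ∀ u w → Linked u w → ¬ Linked w (transpose u)
  ¬Linked-via u w (inj₁ uw) (inj₁ wσu) = row≢col u (≡.trans uw (≡.trans wσu (row-transpose u)))
  ¬Linked-via u w (inj₁ uw) (inj₂ wσu) = row≢col w (≡.trans (≡.sym uw) (≡.sym (≡.trans wσu (col-transpose u))))
  ¬Linked-via u w (inj₂ uw) (inj₁ wσu) = row≢col w (≡.trans wσu (≡.trans (row-transpose u) uw))
  ¬Linked-via u w (inj₂ uw) (inj₂ wσu) = row≢col u (≡.sym (≡.trans uw (≡.trans wσu (col-transpose u))))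

  no-short-walk : ∀ u → ¬ T (walkBelow adj 3 u (transpose u))
  no-short-walk u below with walkBelow⁻ adj 3 u (transpose u) below
  ... | 0 , _ , uσu = transpose-fixpointFree u (≡.sym (walk-zero⁻ adj u (transpose u) uσu))
  ... | 1 , _ , uσu with w , uw , wσu ← walk-suc⁻ adj 0 u (transpose u) uσu
                    with refl ← walk-zero⁻ adj w (transpose u) wσu =
    ¬Linked-transpose u (adj⁻ uw)
  ... | 2 , _ , uσu with w , uw , wσu ← walk-suc⁻ adj 1 u (transpose u) uσu
                    with w′ , ww′ , w′σu ← walk-suc⁻ adj 0 w (transpose u) wσu
                    with refl ← walk-zero⁻ adj w′ (transpose u) w′σu =
    ¬Linked-via u w (adj⁻ uw) (adj⁻ ww′)
  ... | suc (suc (suc _)) , s≤s (s≤s (s≤s ())) , _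

  common-neighbour : ∀ u v → row u ≢ row v → col u ≢ col v → transpose u ≢ v → T (walk adj 2 u v)
  common-neighbour u v row≢ col≢ σu≢v with row u ≟ᶠ col v | row v ≟ᶠ col u
  ... | no ru≢cv | _ = walk-two adj u (vertexAt ru≢cv) v
    (adj⁺ (λ u≡w → col≢ (≡.trans (cong col u≡w) (col-vertexAt ru≢cv))) (inj₁ (≡.sym (row-vertexAt ru≢cv))))
    (adj⁺ (λ w≡v → row≢ (≡.trans (≡.sym (row-vertexAt ru≢cv)) (cong row w≡v))) (inj₂ (col-vertexAt ru≢cv)))
  ... | yes _ | no rv≢cu = walk-two adj u (vertexAt rv≢cu) v
    (adj⁺ (λ u≡w → row≢ (≡.trans (cong row u≡w) (row-vertexAt rv≢cu))) (inj₂ (≡.sym (col-vertexAt rv≢cu))))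
    (adj⁺ (λ w≡v → col≢ (≡.trans (≡.sym (col-vertexAt rv≢cu)) (cong col w≡v))) (inj₁ (row-vertexAt rv≢cu)))
  ... | yes ru≡cv | yes rv≡cu = contradiction (vertex-injective vertex-σu≡vertex-v) σu≢v
    where
    vertex-σu≡vertex-v : vertex N (transpose u) ≡ vertex N v
    vertex-σu≡vertex-v = ≡.trans (vertex-vertexAt (row≢col u ∘ ≡.sym)) (cong₂ _,_ (≡.sym rv≡cu) ru≡cv)

  short-walk : ∀ u v → transpose u ≢ v → T (walkBelow adj 3 u v)
  short-walk u v σu≢v = by-cases (u ≟ᶠ v) (row u ≟ᶠ row v) (col u ≟ᶠ col v)
    where
    by-cases : Dec (u ≡ v) → Dec (row u ≡ row v) → Dec (col u ≡ col v) → T (walkBelow adj 3 u v)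
    by-cases (yes u≡v) _          _          =
      walkBelow⁺ adj 3 0 u v (s≤s z≤n) (walk-zero⁺ adj u v u≡v)
    by-cases (no u≢v)  (yes row≡) _          =
      walkBelow⁺ adj 3 1 u v (s≤s (s≤s z≤n)) (walk-one adj u v (adj⁺ u≢v (inj₁ row≡)))
    by-cases (no u≢v)  (no _)     (yes col≡) =
      walkBelow⁺ adj 3 1 u v (s≤s (s≤s z≤n)) (walk-one adj u v (adj⁺ u≢v (inj₂ col≡)))
    by-cases (no _)    (no row≢)  (no col≢)  =
      walkBelow⁺ adj 3 2 u v ℕ.≤-refl (common-neighbour u v row≢ col≢ σu≢v)

  module _ (third : ∀ {i j : Fin N} → i ≢ j → ∃ λ c → c ≢ i × c ≢ j) where

    walk-three : ∀ u → T (walk adj 3 u (transpose u))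
    walk-three u with c , c≢i , c≢j ← third (row≢col u) =
      walk-suc⁺ adj 2 u (vertexAt i≢c) (transpose u) u~w₁
        (walk-two adj (vertexAt i≢c) (vertexAt j≢c) (transpose u) w₁~w₂ w₂~σu)
      where
      i≢c : row u ≢ c
      i≢c = c≢i ∘ ≡.sym
      j≢c : col u ≢ c
      j≢c = c≢j ∘ ≡.sym
      u~w₁ : T (adj u (vertexAt i≢c))
      u~w₁ = adj⁺ (λ u≡w₁ → j≢c (≡.trans (cong col u≡w₁) (col-vertexAt i≢c)))
                  (inj₁ (≡.sym (row-vertexAt i≢c)))
      w₁~w₂ : T (adj (vertexAt i≢c) (vertexAt j≢c))
      w₁~w₂ = adj⁺ (λ w₁≡w₂ → row≢col u (≡.trans (≡.sym (row-vertexAt i≢c))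
                                                 (≡.trans (cong row w₁≡w₂) (row-vertexAt j≢c))))
                   (inj₂ (≡.trans (col-vertexAt i≢c) (≡.sym (col-vertexAt j≢c))))
      w₂~σu : T (adj (vertexAt j≢c) (transpose u))
      w₂~σu = adj⁺ (λ w₂≡σu → c≢i (≡.trans (≡.sym (col-vertexAt j≢c))
                                           (≡.trans (cong col w₂≡σu) (col-transpose u))))
                   (inj₁ (≡.trans (row-vertexAt j≢c) (≡.sym (row-transpose u))))

    distIs-3 : ∀ u v → distIs adj 3 u v ≡ ⌊ transpose u ≟ᶠ v ⌋
    distIs-3 u v with transpose u ≟ᶠ v
    ... | yes refl = distIs-≡-true adj 3 u v (walk-three u) (no-short-walk u)
    ... | no σu≢v  = distIs-≡-false adj 3 u v (short-walk u v σu≢v)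

    distMatrix-3 : ∀ u v → distMatrix adj 3 u v ≡ permutationMatrix transpose u v
    distMatrix-3 u v = cong boolℤ (distIs-3 u v)

    adjMatrix-distMatrix-3-comm :
      ∀ u v → (adjMatrix adj ⊗ distMatrix adj 3) u v ≡ (distMatrix adj 3 ⊗ adjMatrix adj) u v
    adjMatrix-distMatrix-3-comm u v = begin
      (adjMatrix adj ⊗ distMatrix adj 3) u v
        ≡⟨ ⊗-permutationMatrixʳ transpose (distMatrix adj 3) distMatrix-3 transpose-involutive (adjMatrix adj) u v ⟩
      boolℤ (adj u (transpose v))
        ≡⟨ cong boolℤ (adj-transpose u v) ⟩
      boolℤ (adj (transpose u) v)
        ≡⟨ ⊗-permutationMatrixˡ transpose (distMatrix adj 3) distMatrix-3 (adjMatrix adj) u v ⟨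
      (distMatrix adj 3 ⊗ adjMatrix adj) u v
        ∎

-- The ring of integer polynomials

infix 4 _≈_

-- Wrapping _≈P_ in a record lets Agda infer p and q from a proof of p ≈ q.
record _≈_ (p q : Poly) : Set where
  constructor mk≈
  field coeff-≡ : p ≈P q

open _≈_

≈-setoid : Setoid _ _
≈-setoid = record
  { Carrier = Poly
  ; _≈_ = _≈_
  ; isEquivalence = record
    { refl = mk≈ λ _ → refl
    ; sym = λ p≈q → mk≈ λ i → ≡.sym (coeff-≡ p≈q i)
    ; trans = λ p≈q q≈r → mk≈ λ i → ≡.trans (coeff-≡ p≈q i) (coeff-≡ q≈r i) } }

open Setoid ≈-setoid using () renaming (refl to ≈-refl; sym to ≈-sym; trans to ≈-trans)

≡⇒≈ : ∀ {p q} → p ≡ q → p ≈ q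
≡⇒≈ refl = ≈-refl

∷-cong : ∀ {a b p q} → a ≡ b → p ≈ q → (a ∷ p) ≈ (b ∷ q)
∷-cong a≡b p≈q = mk≈ λ { zero → a≡b ; (suc i) → coeff-≡ p≈q i }

coeff-+P : ∀ p q i → coeff (p +P q) i ≡ coeff p i ℤ.+ coeff q i
coeff-+P []      q       i       = ≡.sym (ℤ.+-identityˡ _)
coeff-+P (a ∷ p) []      i       = ≡.sym (ℤ.+-identityʳ _)
coeff-+P (a ∷ p) (b ∷ q) zero    = refl
coeff-+P (a ∷ p) (b ∷ q) (suc i) = coeff-+P p q i

coeff-scaleP : ∀ a p i → coeff (scaleP a p) i ≡ a ℤ.* coeff p i
coeff-scaleP a []      i       = ≡.sym (ℤ.*-zeroʳ a)
coeff-scaleP a (b ∷ p) zero    = refl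
coeff-scaleP a (b ∷ p) (suc i) = coeff-scaleP a p i

module _ where
  open ≡.≡-Reasoning

  +P-cong : ∀ {p p′ q q′} → p ≈ p′ → q ≈ q′ → (p +P q) ≈ (p′ +P q′)
  +P-cong {p} {p′} {q} {q′} p≈p′ q≈q′ = mk≈ λ i → begin
    coeff (p +P q) i           ≡⟨ coeff-+P p q i ⟩
    coeff p i ℤ.+ coeff q i    ≡⟨ cong₂ ℤ._+_ (coeff-≡ p≈p′ i) (coeff-≡ q≈q′ i) ⟩
    coeff p′ i ℤ.+ coeff q′ i  ≡⟨ coeff-+P p′ q′ i ⟨
    coeff (p′ +P q′) i         ∎

  +P-assoc : ∀ p q r → ((p +P q) +P r) ≈ (p +P (q +P r))
  +P-assoc p q r = mk≈ λ i → begin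
    coeff ((p +P q) +P r) i                   ≡⟨ coeff-+P (p +P q) r i ⟩
    coeff (p +P q) i ℤ.+ coeff r i            ≡⟨ cong (ℤ._+ coeff r i) (coeff-+P p q i) ⟩
    coeff p i ℤ.+ coeff q i ℤ.+ coeff r i     ≡⟨ ℤ.+-assoc (coeff p i) _ _ ⟩
    coeff p i ℤ.+ (coeff q i ℤ.+ coeff r i)   ≡⟨ cong (λ x → coeff p i ℤ.+ x) (coeff-+P q r i) ⟨
    coeff p i ℤ.+ coeff (q +P r) i            ≡⟨ coeff-+P p (q +P r) i ⟨
    coeff (p +P (q +P r)) i                   ∎

  +P-comm : ∀ p q → (p +P q) ≈ (q +P p)
  +P-comm p q = mk≈ λ i → begin
    coeff (p +P q) i         ≡⟨ coeff-+P p q i ⟩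
    coeff p i ℤ.+ coeff q i  ≡⟨ ℤ.+-comm (coeff p i) _ ⟩
    coeff q i ℤ.+ coeff p i  ≡⟨ coeff-+P q p i ⟨
    coeff (q +P p) i         ∎

  +P-identityʳ : ∀ p → (p +P []) ≈ p
  +P-identityʳ p = mk≈ λ i → ≡.trans (coeff-+P p [] i) (ℤ.+-identityʳ _)

  scaleP-cong : ∀ a {p q} → p ≈ q → scaleP a p ≈ scaleP a q
  scaleP-cong a {p} {q} p≈q = mk≈ λ i → begin
    coeff (scaleP a p) i  ≡⟨ coeff-scaleP a p i ⟩
    a ℤ.* coeff p i       ≡⟨ cong (a ℤ.*_) (coeff-≡ p≈q i) ⟩
    a ℤ.* coeff q i       ≡⟨ coeff-scaleP a q i ⟨
    coeff (scaleP a q) i  ∎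

  scaleP-distrib-+P : ∀ a p q → scaleP a (p +P q) ≈ (scaleP a p +P scaleP a q)
  scaleP-distrib-+P a p q = mk≈ λ i → begin
    coeff (scaleP a (p +P q)) i                     ≡⟨ coeff-scaleP a (p +P q) i ⟩
    a ℤ.* coeff (p +P q) i                          ≡⟨ cong (a ℤ.*_) (coeff-+P p q i) ⟩
    a ℤ.* (coeff p i ℤ.+ coeff q i)                 ≡⟨ ℤ.*-distribˡ-+ a (coeff p i) _ ⟩
    a ℤ.* coeff p i ℤ.+ a ℤ.* coeff q i             ≡⟨ cong₂ ℤ._+_ (coeff-scaleP a p i) (coeff-scaleP a q i) ⟨
    coeff (scaleP a p) i ℤ.+ coeff (scaleP a q) i   ≡⟨ coeff-+P (scaleP a p) (scaleP a q) i ⟨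
    coeff (scaleP a p +P scaleP a q) i              ∎

  scaleP-scaleP : ∀ a b p → scaleP (a ℤ.* b) p ≈ scaleP a (scaleP b p)
  scaleP-scaleP a b p = mk≈ λ i → begin
    coeff (scaleP (a ℤ.* b) p) i   ≡⟨ coeff-scaleP (a ℤ.* b) p i ⟩
    a ℤ.* b ℤ.* coeff p i          ≡⟨ ℤ.*-assoc a b _ ⟩
    a ℤ.* (b ℤ.* coeff p i)        ≡⟨ cong (a ℤ.*_) (coeff-scaleP b p i) ⟨
    a ℤ.* coeff (scaleP b p) i     ≡⟨ coeff-scaleP a (scaleP b p) i ⟨
    coeff (scaleP a (scaleP b p)) i ∎

  scaleP-zero : ∀ p → scaleP (+ 0) p ≈ []
  scaleP-zero p = mk≈ λ i → coeff-scaleP (+ 0) p i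

  scaleP-one : ∀ p → scaleP (+ 1) p ≈ p
  scaleP-one p = mk≈ λ i → ≡.trans (coeff-scaleP (+ 1) p i) (ℤ.*-identityˡ _)

-P_ : Poly → Poly
-P p = scaleP (- + 1) p

+P-inverseʳ : ∀ p → (p +P (-P p)) ≈ []
+P-inverseʳ p = mk≈ λ i → ≡.trans (coeff-+P p (-P p) i) (≡.trans
  (cong (λ x → coeff p i ℤ.+ x) (≡.trans (coeff-scaleP (- + 1) p i) (ℤ.-1*i≡-i _)))
  (ℤ.+-inverseʳ (coeff p i)))

+P-commutativeMonoid : CommutativeMonoid _ _
+P-commutativeMonoid = record
  { Carrier = Poly ; _≈_ = _≈_ ; _∙_ = _+P_ ; ε = []
  ; isCommutativeMonoid = record
    { isMonoid = record
      { isSemigroup = record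
        { isMagma = record { isEquivalence = Setoid.isEquivalence ≈-setoid ; ∙-cong = +P-cong }
        ; assoc = +P-assoc }
      ; identity = (λ _ → ≈-refl) , +P-identityʳ }
    ; comm = +P-comm } }

private
  module +P = CommutativeSemigroupProperties
    (CommutativeMonoid.commutativeSemigroup +P-commutativeMonoid)

open import Relation.Binary.Reasoning.Setoid ≈-setoid

0∷[]≈[] : (+ 0 ∷ []) ≈ []
0∷[]≈[] = mk≈ λ { zero → refl ; (suc i) → refl }

*P-congˡ : ∀ p {q q′} → q ≈ q′ → (p *P q) ≈ (p *P q′)
*P-congˡ []      q≈q′ = ≈-refl
*P-congˡ (a ∷ p) q≈q′ = +P-cong (scaleP-cong a q≈q′) (∷-cong refl (*P-congˡ p q≈q′))

*P-zeroʳ : ∀ p → (p *P []) ≈ []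
*P-zeroʳ []      = ≈-refl
*P-zeroʳ (a ∷ p) = ≈-trans (∷-cong refl (*P-zeroʳ p)) 0∷[]≈[]

*P-∷ʳ : ∀ p a q → (p *P (a ∷ q)) ≈ (scaleP a p +P (+ 0 ∷ (p *P q)))
*P-∷ʳ []      a q = ≈-sym 0∷[]≈[]
*P-∷ʳ (b ∷ p) a q = ∷-cong (cong (ℤ._+ + 0) (ℤ.*-comm b a)) (begin
  scaleP b q +P (p *P (a ∷ q))                    ≈⟨ +P-cong ≈-refl (*P-∷ʳ p a q) ⟩
  scaleP b q +P (scaleP a p +P (+ 0 ∷ (p *P q)))  ≈⟨ +P.x∙yz≈y∙xz (scaleP b q) (scaleP a p) _ ⟩
  scaleP a p +P (scaleP b q +P (+ 0 ∷ (p *P q)))  ∎)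

*P-comm : ∀ p q → (p *P q) ≈ (q *P p)
*P-comm []      q = ≈-sym (*P-zeroʳ q)
*P-comm (a ∷ p) q = begin
  scaleP a q +P (+ 0 ∷ (p *P q))  ≈⟨ +P-cong ≈-refl (∷-cong refl (*P-comm p q)) ⟩
  scaleP a q +P (+ 0 ∷ (q *P p))  ≈⟨ *P-∷ʳ q a p ⟨
  q *P (a ∷ p)                    ∎

*P-cong : ∀ {p p′ q q′} → p ≈ p′ → q ≈ q′ → (p *P q) ≈ (p′ *P q′)
*P-cong {p} {p′} {q} {q′} p≈p′ q≈q′ = begin
  p *P q    ≈⟨ *P-congˡ p q≈q′ ⟩
  p *P q′   ≈⟨ *P-comm p q′ ⟩
  q′ *P p   ≈⟨ *P-congˡ q′ p≈p′ ⟩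
  q′ *P p′  ≈⟨ *P-comm q′ p′ ⟩
  p′ *P q′  ∎

*P-congʳ : ∀ {p p′} q → p ≈ p′ → (p *P q) ≈ (p′ *P q)
*P-congʳ q p≈p′ = *P-cong p≈p′ (≈-refl {q})

*P-distribˡ : ∀ r p q → (r *P (p +P q)) ≈ ((r *P p) +P (r *P q))
*P-distribˡ []      p q = ≈-refl
*P-distribˡ (a ∷ r) p q = begin
  scaleP a (p +P q) +P (+ 0 ∷ (r *P (p +P q)))
    ≈⟨ +P-cong (scaleP-distrib-+P a p q) (∷-cong refl (*P-distribˡ r p q)) ⟩
  (scaleP a p +P scaleP a q) +P ((+ 0 ∷ (r *P p)) +P (+ 0 ∷ (r *P q)))
    ≈⟨ +P.interchange (scaleP a p) _ _ _ ⟩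
  (scaleP a p +P (+ 0 ∷ (r *P p))) +P (scaleP a q +P (+ 0 ∷ (r *P q)))
    ∎

*P-distribʳ : ∀ r p q → ((p +P q) *P r) ≈ ((p *P r) +P (q *P r))
*P-distribʳ r p q = begin
  (p +P q) *P r           ≈⟨ *P-comm (p +P q) r ⟩
  r *P (p +P q)           ≈⟨ *P-distribˡ r p q ⟩
  (r *P p) +P (r *P q)    ≈⟨ +P-cong (*P-comm r p) (*P-comm r q) ⟩
  (p *P r) +P (q *P r)    ∎

scaleP-*P : ∀ a q r → (scaleP a q *P r) ≈ scaleP a (q *P r)
scaleP-*P a []      r = ≈-refl
scaleP-*P a (b ∷ q) r = begin
  scaleP (a ℤ.* b) r +P (+ 0 ∷ (scaleP a q *P r))
    ≈⟨ +P-cong (scaleP-scaleP a b r) (∷-cong (≡.sym (ℤ.*-zeroʳ a)) (scaleP-*P a q r)) ⟩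
  scaleP a (scaleP b r) +P scaleP a (+ 0 ∷ (q *P r))
    ≈⟨ scaleP-distrib-+P a (scaleP b r) _ ⟨
  scaleP a (scaleP b r +P (+ 0 ∷ (q *P r)))
    ∎

0∷-*P : ∀ p q → ((+ 0 ∷ p) *P q) ≈ (+ 0 ∷ (p *P q))
0∷-*P p q = +P-cong (scaleP-zero q) ≈-refl

*P-assoc : ∀ p q r → ((p *P q) *P r) ≈ (p *P (q *P r))
*P-assoc []      q r = ≈-refl
*P-assoc (a ∷ p) q r = begin
  (scaleP a q +P (+ 0 ∷ (p *P q))) *P r
    ≈⟨ *P-distribʳ r (scaleP a q) _ ⟩
  (scaleP a q *P r) +P ((+ 0 ∷ (p *P q)) *P r)
    ≈⟨ +P-cong (scaleP-*P a q r) (≈-trans (0∷-*P (p *P q) r) (∷-cong refl (*P-assoc p q r))) ⟩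
  scaleP a (q *P r) +P (+ 0 ∷ (p *P (q *P r)))
    ∎

1P : Poly
1P = constP (+ 1)

*P-identityˡ : ∀ p → (1P *P p) ≈ p
*P-identityˡ p = ≈-trans (+P-cong (scaleP-one p) 0∷[]≈[]) (+P-identityʳ p)

polyRing : CommutativeRing _ _
polyRing = record
  { Carrier = Poly ; _≈_ = _≈_ ; _+_ = _+P_ ; _*_ = _*P_ ; -_ = -P_ ; 0# = [] ; 1# = 1P
  ; isCommutativeRing = record
    { isRing = record
      { +-isAbelianGroup = record
        { isGroup = record
          { isMonoid = CommutativeMonoid.isMonoid +P-commutativeMonoid
          ; inverse = (λ p → ≈-trans (+P-comm (-P p) p) (+P-inverseʳ p)) , +P-inverseʳ
          ; ⁻¹-cong = scaleP-cong (- + 1) }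
        ; comm = +P-comm }
      ; *-cong = *P-cong
      ; *-assoc = *P-assoc
      ; *-identity = *P-identityˡ , (λ p → ≈-trans (*P-comm p 1P) (*P-identityˡ p))
      ; distrib = *P-distribˡ , *P-distribʳ }
    ; *-comm = *P-comm } }

open RingProperties (CommutativeRing.ring polyRing) using (-‿distribˡ-*)
open AbelianGroupProperties (CommutativeRing.+-abelianGroup polyRing) using (⁻¹-∙-comm)

polyACR : AlmostCommutativeRing _ _
polyACR = fromCommutativeRing polyRing

constP-homomorphism : CommutativeRing.rawRing ℤ.+-*-commutativeRing -Raw-AlmostCommutative⟶ polyACR
constP-homomorphism = record
  { ⟦_⟧ = constP
  ; +-homo = λ _ _ → ≈-refl
  ; *-homo = λ _ _ → ∷-cong (≡.sym (ℤ.+-identityʳ _)) ≈-refl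
  ; -‿homo = λ a → ∷-cong (≡.sym (ℤ.-1*i≡-i a)) ≈-refl
  ; 0-homo = 0∷[]≈[]
  ; 1-homo = ≈-refl }

constP-≟ : (a b : ℤ) → Maybe (constP a ≈ constP b)
constP-≟ a b with a ℤ.≟ b
... | yes refl = just ≈-refl
... | no _     = nothing

open RingSolver (CommutativeRing.rawRing ℤ.+-*-commutativeRing) polyACR constP-homomorphism constP-≟
  using (solve; _:+_; _:*_; :-_; _:=_; con)

-- Determinants: column swaps and rotations

sumFinP≡sum : ∀ {m} (f : Fin m → Poly) → sumFinP f ≡ CommutativeMonoidSum.sum +P-commutativeMonoid f
sumFinP≡sum {zero}  f = refl
sumFinP≡sum {suc m} f = cong (f zero +P_) (sumFinP≡sum (f ∘ suc))

sumFinP-pick : ∀ {m} {f : Fin m → Poly} i → (∀ j → j ≢ i → f j ≈ []) → sumFinP f ≈ f i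
sumFinP-pick {f = f} i others-zero =
  ≈-trans (≡⇒≈ (sumFinP≡sum f)) (sum-pick +P-commutativeMonoid f i others-zero)

sumFinP-cong : ∀ {m} {f g : Fin m → Poly} → (∀ j → f j ≈ g j) → sumFinP f ≈ sumFinP g
sumFinP-cong {zero}  f≈g = ≈-refl
sumFinP-cong {suc m} f≈g = +P-cong (f≈g zero) (sumFinP-cong (f≈g ∘ suc))

sumFinP-neg : ∀ {m} (f : Fin m → Poly) → sumFinP (-P_ ∘ f) ≈ -P sumFinP f
sumFinP-neg {zero}  f = ≈-refl
sumFinP-neg {suc m} f = ≈-trans (+P-cong (≈-refl { -P f zero}) (sumFinP-neg (f ∘ suc))) (⁻¹-∙-comm (f zero) _)

swapAdjacent : ∀ {n} → Fin n → Fin (suc n) → Fin (suc n)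
swapAdjacent zero    zero          = suc zero
swapAdjacent zero    (suc zero)    = zero
swapAdjacent zero    (suc (suc c)) = suc (suc c)
swapAdjacent (suc p) zero          = zero
swapAdjacent (suc p) (suc c)       = suc (swapAdjacent p c)

swapAdjacent-involutive : ∀ {n} (p : Fin n) c → swapAdjacent p (swapAdjacent p c) ≡ c
swapAdjacent-involutive zero    zero          = refl
swapAdjacent-involutive zero    (suc zero)    = refl
swapAdjacent-involutive zero    (suc (suc c)) = refl
swapAdjacent-involutive (suc p) zero          = refl
swapAdjacent-involutive (suc p) (suc c)       = cong suc (swapAdjacent-involutive p c)

swapAdjacent-inject₁ : ∀ {n} (p : Fin n) → swapAdjacent p (inject₁ p) ≡ suc p
swapAdjacent-inject₁ zero    = refl
swapAdjacent-inject₁ (suc p) = cong suc (swapAdjacent-inject₁ p)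

swapAdjacent-suc : ∀ {n} (p : Fin n) → swapAdjacent p (suc p) ≡ inject₁ p
swapAdjacent-suc p = ≡.trans (cong (swapAdjacent p) (≡.sym (swapAdjacent-inject₁ p)))
                             (swapAdjacent-involutive p (inject₁ p))

swapAdjacent-punchIn-suc : ∀ {n} (p : Fin n) c →
  swapAdjacent p (punchIn (suc p) c) ≡ punchIn (inject₁ p) c
swapAdjacent-punchIn-suc zero    zero    = refl
swapAdjacent-punchIn-suc zero    (suc c) = refl
swapAdjacent-punchIn-suc (suc p) zero    = refl
swapAdjacent-punchIn-suc (suc p) (suc c) = cong suc (swapAdjacent-punchIn-suc p c)

swapAdjacent-punchIn-inject₁ : ∀ {n} (p : Fin n) c →
  swapAdjacent p (punchIn (inject₁ p) c) ≡ punchIn (suc p) c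
swapAdjacent-punchIn-inject₁ p c = ≡.trans (cong (swapAdjacent p) (≡.sym (swapAdjacent-punchIn-suc p c)))
                                           (swapAdjacent-involutive p (punchIn (suc p) c))

swapAdjacent-fixes : ∀ {n} (p : Fin (suc n)) j → j ≢ inject₁ p → j ≢ suc p → swapAdjacent p j ≡ j
swapAdjacent-fixes         zero    zero          j≢p _     = contradiction refl j≢p
swapAdjacent-fixes         zero    (suc zero)    _   j≢p+1 = contradiction refl j≢p+1
swapAdjacent-fixes         zero    (suc (suc j)) _   _     = refl
swapAdjacent-fixes {suc n} (suc p) zero          _   _     = refl
swapAdjacent-fixes {suc n} (suc p) (suc j)       j≢p j≢p+1 =
  cong suc (swapAdjacent-fixes p j (j≢p ∘ cong suc) (j≢p+1 ∘ cong suc))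

swapAdjacent-punchIn : ∀ {n} (p : Fin (suc n)) j → j ≢ inject₁ p → j ≢ suc p →
  ∃ λ p′ → ∀ c → swapAdjacent p (punchIn j c) ≡ punchIn j (swapAdjacent p′ c)
swapAdjacent-punchIn zero zero       j≢p _     = contradiction refl j≢p
swapAdjacent-punchIn zero (suc zero) _   j≢p+1 = contradiction refl j≢p+1
swapAdjacent-punchIn {suc n} zero (suc (suc j)) _ _ = zero , commute
  where
  commute : ∀ c → swapAdjacent zero (punchIn (suc (suc j)) c) ≡ punchIn (suc (suc j)) (swapAdjacent zero c)
  commute zero          = refl
  commute (suc zero)    = refl
  commute (suc (suc c)) = refl
swapAdjacent-punchIn {suc n} (suc p) zero _ _ = p , λ _ → refl
swapAdjacent-punchIn {suc n} (suc p) (suc j) j≢p j≢p+1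
  with p′ , commute ← swapAdjacent-punchIn p j (j≢p ∘ cong suc) (j≢p+1 ∘ cong suc) =
  suc p′ , λ { zero → refl ; (suc c) → cong suc (commute c) }

sumFinP-swapAdjacent : ∀ {n} (p : Fin n) (f : Fin (suc n) → Poly) →
  sumFinP f ≈ sumFinP (f ∘ swapAdjacent p)
sumFinP-swapAdjacent zero    f = +P.x∙yz≈y∙xz (f zero) (f (suc zero)) _
sumFinP-swapAdjacent (suc p) f = +P-cong (≈-refl {f zero}) (sumFinP-swapAdjacent p (f ∘ suc))

permuteColumns : ∀ {m} → (Fin m → Fin m → Poly) → (Fin m → Fin m) → Fin m → Fin m → Poly
permuteColumns M π r c = M r (π c)

minor : ∀ {m} → (Fin (suc m) → Fin (suc m) → Poly) → Fin (suc m) → Fin m → Fin m → Poly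
minor M j r c = M (suc r) (punchIn j c)

laplaceTerm : ∀ {m} → (Fin (suc m) → Fin (suc m) → Poly) → Fin (suc m) → Poly
laplaceTerm M j = signP j *P (M zero j *P det (minor M j))

det-cong : ∀ {m} {M N : Fin m → Fin m → Poly} → (∀ r c → M r c ≈ N r c) → det M ≈ det N
det-cong {zero}  M≈N = ≈-refl
det-cong {suc m} M≈N = sumFinP-cong λ j →
  *P-congˡ (signP j) (*P-cong (M≈N zero j) (det-cong λ r c → M≈N (suc r) (punchIn j c)))

signP-suc : ∀ {m} (j : Fin m) → signP (suc j) ≈ -P signP j
signP-suc j = ≈-refl

signP-inject₁ : ∀ {m} (j : Fin m) → signP (inject₁ j) ≡ signP j
signP-inject₁ j = cong (λ k → constP (ℤ.-1ℤ ℤ.^ k)) (toℕ-inject₁ j)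

signP-square : ∀ {m} (j : Fin m) → (signP j *P signP j) ≈ 1P
signP-square zero    = ≈-refl
signP-square (suc j) = begin
  signP (suc j) *P signP (suc j)  ≈⟨ *P-cong (signP-suc j) (signP-suc j) ⟩
  (-P signP j) *P (-P signP j)    ≈⟨ solve 1 (λ s → (:- s) :* (:- s) := s :* s) ≈-refl (signP j) ⟩
  signP j *P signP j              ≈⟨ signP-square j ⟩
  1P                              ∎

det-swapAdjacent : ∀ {n} (M : Fin (suc n) → Fin (suc n) → Poly) (p : Fin n) →
  det (permuteColumns M (swapAdjacent p)) ≈ -P det M
laplaceTerm-swapAdjacent : ∀ {n} (M : Fin (suc n) → Fin (suc n) → Poly) (p : Fin n) j →
  laplaceTerm (permuteColumns M (swapAdjacent p)) (swapAdjacent p j) ≈ -P laplaceTerm M j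

det-swapAdjacent {n} M p = begin
  sumFinP (laplaceTerm M′)                   ≈⟨ sumFinP-swapAdjacent p (laplaceTerm M′) ⟩
  sumFinP (laplaceTerm M′ ∘ swapAdjacent p)  ≈⟨ sumFinP-cong (laplaceTerm-swapAdjacent M p) ⟩
  sumFinP (-P_ ∘ laplaceTerm M)              ≈⟨ sumFinP-neg (laplaceTerm M) ⟩
  -P det M                                   ∎
  where
  M′ : Fin (suc n) → Fin (suc n) → Poly
  M′ = permuteColumns M (swapAdjacent p)

laplaceTerm-swapAdjacent {suc n} M p j with j ≟ᶠ inject₁ p | j ≟ᶠ suc p
... | yes refl | _ rewrite swapAdjacent-inject₁ p = begin
  laplaceTerm (permuteColumns M (swapAdjacent p)) (suc p)
    ≈⟨ *P-cong (signP-suc p) (*P-cong (≡⇒≈ (cong (M zero) (swapAdjacent-suc p)))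
                              (det-cong λ r c → ≡⇒≈ (cong (M (suc r)) (swapAdjacent-punchIn-suc p c)))) ⟩
  (-P signP p) *P (M zero (inject₁ p) *P det (minor M (inject₁ p)))
    ≈⟨ -‿distribˡ-* (signP p) _ ⟨
  -P (signP p *P (M zero (inject₁ p) *P det (minor M (inject₁ p))))
    ≡⟨ cong (λ s → -P (s *P (M zero (inject₁ p) *P det (minor M (inject₁ p))))) (signP-inject₁ p) ⟨
  -P laplaceTerm M (inject₁ p)
    ∎
... | no _ | yes refl rewrite swapAdjacent-suc p = begin
  laplaceTerm (permuteColumns M (swapAdjacent p)) (inject₁ p)
    ≈⟨ *P-cong (≡⇒≈ (signP-inject₁ p)) (*P-cong (≡⇒≈ (cong (M zero) (swapAdjacent-inject₁ p)))
                              (det-cong λ r c → ≡⇒≈ (cong (M (suc r)) (swapAdjacent-punchIn-inject₁ p c)))) ⟩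
  signP p *P (M zero (suc p) *P det (minor M (suc p)))
    ≈⟨ solve 2 (λ s t → s :* t := :- ((:- s) :* t)) ≈-refl (signP p) _ ⟩
  -P ((-P signP p) *P (M zero (suc p) *P det (minor M (suc p))))
    ≈⟨ scaleP-cong (- + 1) (*P-congʳ _ (signP-suc p)) ⟨
  -P laplaceTerm M (suc p)
    ∎
... | no j≢p | no j≢p+1 with p′ , commute ← swapAdjacent-punchIn p j j≢p j≢p+1
  rewrite swapAdjacent-fixes p j j≢p j≢p+1 = begin
  laplaceTerm (permuteColumns M (swapAdjacent p)) j
    ≈⟨ *P-congˡ (signP j) (*P-cong (≡⇒≈ (cong (M zero) (swapAdjacent-fixes p j j≢p j≢p+1)))
                                   (det-cong λ r c → ≡⇒≈ (cong (M (suc r)) (commute c)))) ⟩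
  signP j *P (M zero j *P det (permuteColumns (minor M j) (swapAdjacent p′)))
    ≈⟨ *P-congˡ (signP j) (*P-congˡ (M zero j) (det-swapAdjacent (minor M j) p′)) ⟩
  signP j *P (M zero j *P (-P det (minor M j)))
    ≈⟨ solve 3 (λ s a d → s :* (a :* (:- d)) := :- (s :* (a :* d))) ≈-refl (signP j) (M zero j) _ ⟩
  -P laplaceTerm M j
    ∎

-- permuteColumns M (rotate k) moves column 0 of M to position k.
rotate : ∀ {n} → Fin n → Fin n → Fin n
rotate {suc n}       zero    c       = c
rotate {suc (suc n)} (suc k) zero    = suc zero
rotate {suc (suc n)} (suc k) (suc c) = punchIn (suc zero) (rotate k c)

rotate-suc : ∀ {n} (k : Fin n) c → rotate (suc k) c ≡ rotate (inject₁ k) (swapAdjacent k c)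
rotate-suc {suc n} zero    zero          = refl
rotate-suc {suc n} zero    (suc zero)    = refl
rotate-suc {suc n} zero    (suc (suc c)) = refl
rotate-suc {suc n} (suc k) zero          = refl
rotate-suc {suc n} (suc k) (suc c)       = cong (punchIn (suc zero)) (rotate-suc k c)

rotate-self : ∀ {n} (k : Fin (suc n)) → rotate k k ≡ zero
rotate-self         zero    = refl
rotate-self {suc n} (suc k) = cong (punchIn (suc zero)) (rotate-self k)

punchIn-rotate : ∀ {n} (k c : Fin n) → c ≢ k → punchIn (suc k) (rotate k c) ≡ suc c
punchIn-rotate               zero    zero    c≢k = contradiction refl c≢k
punchIn-rotate {suc (suc n)} zero    (suc c) _   = refl
punchIn-rotate {suc (suc n)} (suc k) zero    _   = refl
punchIn-rotate {suc (suc n)} (suc k) (suc c) c≢k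
  with rotate k c | punchIn-rotate k c (c≢k ∘ cong suc)
... | suc x | eq = cong suc eq

det-rotate : ∀ {n} (M : Fin (suc n) → Fin (suc n) → Poly) k →
  det (permuteColumns M (rotate k)) ≈ signP k *P det M
det-rotate M = <-weakInduction (λ k → det (permuteColumns M (rotate k)) ≈ signP k *P det M)
  (≈-sym (*P-identityˡ (det M))) step
  where
  step : ∀ k → det (permuteColumns M (rotate (inject₁ k))) ≈ signP (inject₁ k) *P det M →
         det (permuteColumns M (rotate (suc k))) ≈ signP (suc k) *P det M
  step k ih = begin
    det (permuteColumns M (rotate (suc k)))
      ≈⟨ det-cong (λ r c → ≡⇒≈ (cong (M r) (rotate-suc k c))) ⟩
    det (permuteColumns (permuteColumns M (rotate (inject₁ k))) (swapAdjacent k))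
      ≈⟨ det-swapAdjacent (permuteColumns M (rotate (inject₁ k))) k ⟩
    -P det (permuteColumns M (rotate (inject₁ k)))
      ≈⟨ scaleP-cong (- + 1) ih ⟩
    -P (signP (inject₁ k) *P det M)
      ≡⟨ cong (λ s → -P (s *P det M)) (signP-inject₁ k) ⟩
    -P (signP k *P det M)
      ≈⟨ -‿distribˡ-* (signP k) (det M) ⟩
    (-P signP k) *P det M
      ≈⟨ *P-congʳ (det M) (signP-suc k) ⟨
    signP (suc k) *P det M
      ∎

-- Determinants of partial involution matrices

X-1 X+1 -1P : Poly
X-1 = X +P constP (- + 1)
X+1 = X +P constP (+ 1)
-1P = constP (- + 1)

open CommutativeMonoidSum (CommutativeRing.*-commutativeMonoid polyRing)
  using () renaming (sum to ∏; sum-remove to ∏-remove; sum-cong-≋ to ∏-cong)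

record Admissible {m} (τ : Fin m → Maybe (Fin m)) (d : Fin m → Poly) : Set where
  field
    symmetric   : ∀ {r s} → τ r ≡ just s → τ s ≡ just r
    irreflexive : ∀ {r} → τ r ≢ just r
    matched-X   : ∀ {r s} → τ r ≡ just s → d r ≡ X

-- pairingMatrix τ d is diag d − P_τ, where P_τ is the 0/1 matrix of the partial involution τ;
-- with τ total and d = X it is X·I − P_τ. The minors met in the Laplace expansion along row 0
-- are (after the column rotation in Matched) again of this shape: the row that lost its partner
-- becomes unmatched, with diagonal entry X or −1.
offDiagonal : ∀ {m} → Maybe (Fin m) → Fin m → Poly
offDiagonal nothing  c = []
offDiagonal (just s) c = if does (s ≟ᶠ c) then -1P else []

pairingMatrix : ∀ {m} → (Fin m → Maybe (Fin m)) → (Fin m → Poly) → Fin m → Fin m → Poly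
pairingMatrix τ d r c = (if does (r ≟ᶠ c) then d r else []) +P offDiagonal (τ r) c

pairedFactor : ∀ {m} → Fin m → Fin m → Poly
pairedFactor r s = if does (r <? s) then X-1 else X+1

pairingFactor : ∀ {m} → (Fin m → Maybe (Fin m)) → (Fin m → Poly) → Fin m → Poly
pairingFactor τ d r = maybe (pairedFactor r) (d r) (τ r)

predMaybe : ∀ {m} → Maybe (Fin (suc m)) → Maybe (Fin m)
predMaybe nothing        = nothing
predMaybe (just zero)    = nothing
predMaybe (just (suc s)) = just s

predMaybe-just : ∀ {m} (x : Maybe (Fin (suc m))) {s} → predMaybe x ≡ just s → x ≡ just (suc s)
predMaybe-just (just (suc s)) refl = refl

restrict : ∀ {m} → (Fin (suc m) → Maybe (Fin (suc m))) → Fin m → Maybe (Fin m)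
restrict τ r = predMaybe (τ (suc r))

restrict-admissible : ∀ {m} {τ : Fin (suc m) → Maybe (Fin (suc m))} {d} (d′ : Fin m → Poly) →
  Admissible τ d → (∀ {r s} → restrict τ r ≡ just s → d′ r ≡ X) → Admissible (restrict τ) d′
restrict-admissible {τ = τ} d′ adm matched-X′ = record
  { symmetric   = λ {r} eq → cong predMaybe (symmetric (predMaybe-just (τ (suc r)) eq))
  ; irreflexive = λ {r} eq → irreflexive (predMaybe-just (τ (suc r)) eq)
  ; matched-X   = matched-X′ }
  where open Admissible adm

offDiagonal-suc : ∀ {m} (x : Maybe (Fin (suc m))) c →
  offDiagonal x (suc c) ≡ offDiagonal (predMaybe x) c
offDiagonal-suc nothing        c = refl
offDiagonal-suc (just zero)    c = refl
offDiagonal-suc (just (suc s)) c = refl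

minor-pairingMatrix : ∀ {m} (τ : Fin (suc m) → Maybe (Fin (suc m))) d r c →
  minor (pairingMatrix τ d) zero r c ≡ pairingMatrix (restrict τ) (d ∘ suc) r c
minor-pairingMatrix τ d r c = cong (_ +P_) (offDiagonal-suc (τ (suc r)) c)

pairingFactor-suc : ∀ {m} (τ : Fin (suc m) → Maybe (Fin (suc m))) d r → τ (suc r) ≢ just zero →
  pairingFactor τ d (suc r) ≡ pairingFactor (restrict τ) (d ∘ suc) r
pairingFactor-suc τ d r τr≢0 with τ (suc r)
... | nothing      = refl
... | just zero    = contradiction refl τr≢0
... | just (suc s) = refl

pairingFactor-default : ∀ {m} (τ : Fin m → Maybe (Fin m)) {d d′ : Fin m → Poly} r → d r ≡ d′ r →
  pairingFactor τ d r ≡ pairingFactor τ d′ r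
pairingFactor-default τ r dr≡d′r = cong (λ x → maybe (pairedFactor r) x (τ r)) dr≡d′r

offDiagonal-zero : ∀ {m} (x : Maybe (Fin (suc m))) a → x ≢ just zero → x ≢ just (suc a) →
  offDiagonal x zero ≡ offDiagonal (predMaybe x) a
offDiagonal-zero nothing        a _   _     = refl
offDiagonal-zero (just zero)    a x≢0 _     = contradiction refl x≢0
offDiagonal-zero (just (suc s)) a _   x≢a+1 =
  ≡.sym (cong (if_then -1P else []) (dec-false (s ≟ᶠ a) (x≢a+1 ∘ cong (just ∘ suc))))

DetFormula : ℕ → Set
DetFormula m = ∀ {τ : Fin m → Maybe (Fin m)} {d} → Admissible τ d →
  det (pairingMatrix τ d) ≈ ∏ (pairingFactor τ d)

restrict-admissible-suc : ∀ {m} {τ : Fin (suc m) → Maybe (Fin (suc m))} {d} →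
  Admissible τ d → Admissible (restrict τ) (d ∘ suc)
restrict-admissible-suc {τ = τ} adm =
  restrict-admissible _ adm λ {r} eq → Admissible.matched-X adm (predMaybe-just (τ (suc r)) eq)

det-pairingMatrix-unmatched : ∀ {m} → DetFormula m →
  ∀ {τ : Fin (suc m) → Maybe (Fin (suc m))} {d} → Admissible τ d → τ zero ≡ nothing →
  det (pairingMatrix τ d) ≈ ∏ (pairingFactor τ d)
det-pairingMatrix-unmatched {m} ih {τ} {d} adm τ0≡nothing = begin
  sumFinP (laplaceTerm M)
    ≈⟨ sumFinP-pick zero others-vanish ⟩
  1P *P (M zero zero *P det (minor M zero))
    ≈⟨ *P-identityˡ _ ⟩
  M zero zero *P det (minor M zero)
    ≈⟨ *P-cong M₀₀≈d₀ (≈-trans (det-cong λ r c → ≡⇒≈ (minor-pairingMatrix τ d r c))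
                               (ih (restrict-admissible-suc adm))) ⟩
  d zero *P ∏ (pairingFactor (restrict τ) (d ∘ suc))
    ≈⟨ *P-cong (≡⇒≈ (cong (maybe (pairedFactor zero) (d zero)) (≡.sym τ0≡nothing)))
               (∏-cong λ r → ≡⇒≈ (≡.sym (pairingFactor-suc τ d r (τr≢0 r)))) ⟩
  ∏ (pairingFactor τ d)
    ∎
  where
  open Admissible adm
  M : Fin (suc m) → Fin (suc m) → Poly
  M = pairingMatrix τ d
  others-vanish : ∀ j → j ≢ zero → laplaceTerm M j ≈ []
  others-vanish zero    j≢0 = contradiction refl j≢0
  others-vanish (suc j) _   = ≈-trans
    (*P-congˡ (signP (suc j)) (*P-congʳ (det (minor M (suc j)))
                                        (≡⇒≈ (cong (λ x → offDiagonal x (suc j)) τ0≡nothing))))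
    (*P-zeroʳ (signP (suc j)))
  M₀₀≈d₀ : M zero zero ≈ d zero
  M₀₀≈d₀ = ≈-trans (≡⇒≈ (cong (λ x → d zero +P offDiagonal x zero) τ0≡nothing)) (+P-identityʳ (d zero))
  τr≢0 : ∀ r → τ (suc r) ≢ just zero
  τr≢0 r eq with () ← ≡.trans (≡.sym (symmetric eq)) τ0≡nothing

-- Row 0 is X e₀ − e₍ₐ₊₁₎, so det M = X · det (minor M 0) ± det (minor M (a+1)). In the second
-- minor the row of a+1 has its only nonzero entry, −1, in column 0; rotating that column to
-- position a puts the −1 on the diagonal, and a becomes an unmatched index with d″ a = −1.
module Matched {m} (ih : DetFormula (suc m)) {τ : Fin (suc (suc m)) → Maybe (Fin (suc (suc m)))} {d}
               (adm : Admissible τ d) (a : Fin (suc m)) (τ0≡a+1 : τ zero ≡ just (suc a)) where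

  open Admissible adm

  M : Fin (suc (suc m)) → Fin (suc (suc m)) → Poly
  M = pairingMatrix τ d

  d′ d″ : Fin (suc m) → Poly
  d′ = d ∘ suc
  d″ = updateAt d′ a (λ _ → -1P)

  τa+1≡0 : τ (suc a) ≡ just zero
  τa+1≡0 = symmetric τ0≡a+1

  τr≢0 : ∀ r → r ≢ a → τ (suc r) ≢ just zero
  τr≢0 r r≢a eq = r≢a (suc-injective (just-injective (≡.trans (≡.sym (symmetric eq)) τ0≡a+1)))

  τr≢a+1 : ∀ r → τ (suc r) ≢ just (suc a)
  τr≢a+1 r eq with () ← ≡.trans (≡.sym (symmetric eq)) τa+1≡0

  restrict-a : restrict τ a ≡ nothing
  restrict-a = cong predMaybe τa+1≡0

  H : Poly
  H = ∏ (removeAt (pairingFactor (restrict τ) d′) a)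

  factor-out : (f : Fin (suc m) → Poly) {x : Poly} → f a ≡ x →
    (∀ j → f (punchIn a j) ≡ pairingFactor (restrict τ) d′ (punchIn a j)) → ∏ f ≈ x *P H
  factor-out f fa≡x agree =
    ≈-trans (∏-remove {i = a} f) (*P-cong (≡⇒≈ fa≡x) (∏-cong λ j → ≡⇒≈ (agree j)))

  minor-rotate : ∀ r c → permuteColumns (minor M (suc a)) (rotate a) r c ≈ pairingMatrix (restrict τ) d″ r c
  minor-rotate r c with c ≟ᶠ a
  ... | no c≢a = begin
    M (suc r) (punchIn (suc a) (rotate a c))  ≡⟨ cong (M (suc r)) (punchIn-rotate a c c≢a) ⟩
    M (suc r) (suc c)                         ≡⟨ minor-pairingMatrix τ d r c ⟩
    pairingMatrix (restrict τ) d′ r c         ≡⟨ cong (_+P offDiagonal (restrict τ r) c) diagonal ⟩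
    pairingMatrix (restrict τ) d″ r c         ∎
    where
    diagonal : (if does (r ≟ᶠ c) then d′ r else []) ≡ (if does (r ≟ᶠ c) then d″ r else [])
    diagonal with r ≟ᶠ c
    ... | yes refl = ≡.sym (updateAt-minimal r a d′ c≢a)
    ... | no _     = refl
  ... | yes refl with r ≟ᶠ a
  ...   | yes refl = begin
    M (suc a) (punchIn (suc a) (rotate a a))  ≡⟨ cong (M (suc a) ∘ punchIn (suc a)) (rotate-self a) ⟩
    offDiagonal (τ (suc a)) zero              ≡⟨ cong (λ x → offDiagonal x zero) τa+1≡0 ⟩
    -1P                                       ≡⟨ updateAt-updates a d′ ⟨
    d″ a                                      ≈⟨ +P-identityʳ (d″ a) ⟨
    d″ a +P []                                ≡⟨ cong (λ x → d″ a +P offDiagonal (predMaybe x) a) τa+1≡0 ⟨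
    d″ a +P offDiagonal (restrict τ a) a      ∎
  ...   | no r≢a = begin
    M (suc r) (punchIn (suc a) (rotate a a))  ≡⟨ cong (M (suc r) ∘ punchIn (suc a)) (rotate-self a) ⟩
    offDiagonal (τ (suc r)) zero              ≡⟨ offDiagonal-zero (τ (suc r)) a (τr≢0 r r≢a) (τr≢a+1 r) ⟩
    offDiagonal (restrict τ r) a              ∎

  M₀₀≈X : M zero zero ≈ X
  M₀₀≈X = begin
    d zero +P offDiagonal (τ zero) zero  ≡⟨ cong (λ x → d zero +P offDiagonal x zero) τ0≡a+1 ⟩
    d zero +P []                         ≈⟨ +P-identityʳ (d zero) ⟩
    d zero                               ≡⟨ matched-X τ0≡a+1 ⟩
    X                                    ∎

  M₀ₐ≡-1 : M zero (suc a) ≡ -1P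
  M₀ₐ≡-1 = ≡.trans (cong (λ x → offDiagonal x (suc a)) τ0≡a+1)
                   (cong (if_then -1P else []) (dec-true (a ≟ᶠ a) refl))

  others-vanish : ∀ j → j ≢ a → laplaceTerm M (suc j) ≈ []
  others-vanish j j≢a = ≈-trans
    (*P-congˡ (signP (suc j)) (*P-congʳ (det (minor M (suc j))) (≡⇒≈ M₀ⱼ≡0)))
    (*P-zeroʳ (signP (suc j)))
    where
    M₀ⱼ≡0 : M zero (suc j) ≡ []
    M₀ⱼ≡0 = ≡.trans (cong (λ x → offDiagonal x (suc j)) τ0≡a+1)
                    (cong (if_then -1P else []) (dec-false (a ≟ᶠ j) (j≢a ∘ ≡.sym)))

  adm″ : Admissible (restrict τ) d″
  adm″ = restrict-admissible d″ adm matched-X″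
    where
    matched-X″ : ∀ {r s} → restrict τ r ≡ just s → d″ r ≡ X
    matched-X″ {r} eq with r ≟ᶠ a
    ... | yes refl with () ← ≡.trans (≡.sym eq) restrict-a
    ... | no r≢a = ≡.trans (updateAt-minimal r a d′ r≢a) (matched-X (predMaybe-just (τ (suc r)) eq))

  det-minor-zero : det (minor M zero) ≈ X *P H
  det-minor-zero = begin
    det (minor M zero)                   ≈⟨ det-cong (λ r c → ≡⇒≈ (minor-pairingMatrix τ d r c)) ⟩
    det (pairingMatrix (restrict τ) d′)  ≈⟨ ih (restrict-admissible-suc adm) ⟩
    ∏ (pairingFactor (restrict τ) d′)    ≈⟨ factor-out (pairingFactor (restrict τ) d′) factor-a (λ _ → refl) ⟩
    X *P H                               ∎
    where
    factor-a : pairingFactor (restrict τ) d′ a ≡ X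
    factor-a = ≡.trans (cong (maybe (pairedFactor a) (d′ a)) restrict-a) (matched-X τa+1≡0)

  det-minor-a : det (minor M (suc a)) ≈ signP a *P (-1P *P H)
  det-minor-a = begin
    det (minor M (suc a))
      ≈⟨ *P-identityˡ _ ⟨
    1P *P det (minor M (suc a))
      ≈⟨ *P-congʳ _ (signP-square a) ⟨
    (signP a *P signP a) *P det (minor M (suc a))
      ≈⟨ *P-assoc (signP a) (signP a) _ ⟩
    signP a *P (signP a *P det (minor M (suc a)))
      ≈⟨ *P-congˡ (signP a) (det-rotate (minor M (suc a)) a) ⟨
    signP a *P det (permuteColumns (minor M (suc a)) (rotate a))
      ≈⟨ *P-congˡ (signP a) (≈-trans (det-cong minor-rotate) (ih adm″)) ⟩
    signP a *P ∏ (pairingFactor (restrict τ) d″)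
      ≈⟨ *P-congˡ (signP a) (factor-out (pairingFactor (restrict τ) d″) factor-a agree) ⟩
    signP a *P (-1P *P H)
      ∎
    where
    factor-a : pairingFactor (restrict τ) d″ a ≡ -1P
    factor-a = ≡.trans (cong (maybe (pairedFactor a) (d″ a)) restrict-a) (updateAt-updates a d′)
    agree : ∀ j → pairingFactor (restrict τ) d″ (punchIn a j) ≡ pairingFactor (restrict τ) d′ (punchIn a j)
    agree j = pairingFactor-default (restrict τ) {d″} {d′} (punchIn a j)
                (updateAt-minimal (punchIn a j) a d′ (punchInᵢ≢i a j))

  ∏-tail : ∏ (pairingFactor τ d ∘ suc) ≈ X+1 *P H
  ∏-tail = factor-out (pairingFactor τ d ∘ suc) (cong (maybe (pairedFactor (suc a)) (d (suc a))) τa+1≡0)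
    λ j → pairingFactor-suc τ d (punchIn a j) (τr≢0 (punchIn a j) (punchInᵢ≢i a j))

  det≈∏ : det M ≈ ∏ (pairingFactor τ d)
  det≈∏ = begin
    sumFinP (laplaceTerm M)
      ≈⟨ +P-cong (≈-refl {laplaceTerm M zero}) (sumFinP-pick a others-vanish) ⟩
    laplaceTerm M zero +P laplaceTerm M (suc a)
      ≈⟨ +P-cong (*P-congˡ 1P (*P-cong M₀₀≈X det-minor-zero))
                 (*P-congˡ (signP (suc a)) (*P-cong (≡⇒≈ M₀ₐ≡-1) det-minor-a)) ⟩
    (1P *P (X *P (X *P H))) +P ((-P s) *P (-1P *P (s *P (-1P *P H))))
      ≈⟨ solve 3 (λ x s h → con (+ 1) :* (x :* (x :* h)) :+ (:- s) :* (con (- + 1) :* (s :* (con (- + 1) :* h)))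
                         := x :* (x :* h) :+ con (- + 1) :* ((s :* s) :* h)) ≈-refl X s H ⟩
    (X *P (X *P H)) +P (-1P *P ((s *P s) *P H))
      ≈⟨ +P-cong (≈-refl {X *P (X *P H)}) (*P-congˡ -1P (*P-congʳ H (signP-square a))) ⟩
    (X *P (X *P H)) +P (-1P *P (1P *P H))
      ≈⟨ solve 2 (λ x h → x :* (x :* h) :+ con (- + 1) :* (con (+ 1) :* h)
                       := (x :+ con (- + 1)) :* ((x :+ con (+ 1)) :* h)) ≈-refl X H ⟩
    X-1 *P (X+1 *P H)
      ≈⟨ *P-cong (≡⇒≈ (cong (maybe (pairedFactor zero) (d zero)) τ0≡a+1)) ∏-tail ⟨
    ∏ (pairingFactor τ d)
      ∎
    where
    s : Poly
    s = signP a

det-pairingMatrix-matched : ∀ {m} → DetFormula m →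
  ∀ {τ : Fin (suc m) → Maybe (Fin (suc m))} {d} → Admissible τ d → ∀ a → τ zero ≡ just (suc a) →
  det (pairingMatrix τ d) ≈ ∏ (pairingFactor τ d)
det-pairingMatrix-matched {suc m} ih adm a τ0≡a+1 = Matched.det≈∏ ih adm a τ0≡a+1

det-pairingMatrix : ∀ {m} → DetFormula m
det-pairingMatrix {zero}          _   = ≈-refl
det-pairingMatrix {suc m} {τ} {d} adm = by-cases (τ zero) refl
  where
  by-cases : ∀ x → τ zero ≡ x → det (pairingMatrix τ d) ≈ ∏ (pairingFactor τ d)
  by-cases nothing        τ0 = det-pairingMatrix-unmatched det-pairingMatrix adm τ0
  by-cases (just zero)    τ0 = contradiction τ0 (Admissible.irreflexive adm)
  by-cases (just (suc a)) τ0 = det-pairingMatrix-matched det-pairingMatrix adm a τ0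

-- Fixed-point-free involutions

private
  module *P = CommutativeSemigroupProperties (CommutativeRing.*-commutativeSemigroup polyRing)

count : ∀ {m} → (Fin m → Bool) → ℕ
count b = CommutativeMonoidSum.sum ℕ.+-0-commutativeMonoid (λ r → if b r then 1 else 0)

count-+-not : ∀ {m} (b : Fin m → Bool) → count b + count (not ∘ b) ≡ m
count-+-not {zero}  b = refl
count-+-not {suc m} b with b zero
... | true  = cong suc (count-+-not (b ∘ suc))
... | false = ≡.trans (ℕ.+-suc (count (b ∘ suc)) _) (cong suc (count-+-not (b ∘ suc)))

∏-if : ∀ {m} (b : Fin m → Bool) p q →
  ∏ (λ r → if b r then p else q) ≈ (p ^P count b) *P (q ^P count (not ∘ b))
∏-if {zero}  b p q = ≈-refl
∏-if {suc m} b p q with b zero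
... | true  = ≈-trans (*P-congˡ p (∏-if (b ∘ suc) p q)) (≈-sym (*P-assoc p _ _))
... | false = ≈-trans (*P-congˡ q (∏-if (b ∘ suc) p q)) (*P.x∙yz≈y∙xz q (p ^P count (b ∘ suc)) _)

constP-neg-boolℤ : ∀ b → constP (- boolℤ b) ≈ (if b then -1P else [])
constP-neg-boolℤ true  = ≈-refl
constP-neg-boolℤ false = 0∷[]≈[]

module _ {m} (σ : Fin m → Fin m) (σ-involutive : ∀ r → σ (σ r) ≡ r) (σ-fixpointFree : ∀ r → σ r ≢ r) where

  private
    below : Fin m → Bool
    below r = does (r <? σ r)

  count-not-below : count (not ∘ below) ≡ count below
  count-not-below = ≡.trans
    (CommutativeMonoidSum.sum-cong-≗ ℕ.+-0-commutativeMonoid (cong (if_then 1 else 0) ∘ not-below))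
    (≡.sym (CommutativeMonoidSum.sum-permute ℕ.+-0-commutativeMonoid _
                                              (permutation σ σ σ-involutive σ-involutive)))
    where
    not-below : ∀ r → not (below r) ≡ below (σ r)
    not-below r rewrite σ-involutive r with <-cmp r (σ r)
    ... | tri< r<σr _ σr≮r = ≡.trans (cong not (dec-true (r <? σ r) r<σr)) (≡.sym (dec-false (σ r <? r) σr≮r))
    ... | tri≈ _ r≡σr _    = contradiction (≡.sym r≡σr) (σ-fixpointFree r)
    ... | tri> r≮σr _ σr<r = ≡.trans (cong not (dec-false (r <? σ r) r≮σr)) (≡.sym (dec-true (σ r <? r) σr<r))

  count-below : count below ≡ m / 2
  count-below = ≡.trans (≡.sym (m*n/n≡m (count below) 2)) (cong (_/ 2) twice)
    where
    twice : count below * 2 ≡ m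
    twice = ≡.trans (ℕ.*-comm (count below) 2) (≡.trans
      (cong (λ k → count below + k) (≡.trans (ℕ.+-identityʳ _) (≡.sym count-not-below)))
      (count-+-not below))

  ∏-pairedFactor : ∏ (λ r → pairedFactor r (σ r)) ≈ (X-1 ^P (m / 2)) *P (X+1 ^P (m / 2))
  ∏-pairedFactor = ≈-trans (∏-if below X-1 X+1)
    (≡⇒≈ (cong₂ (λ k l → (X-1 ^P k) *P (X+1 ^P l)) count-below (≡.trans count-not-below count-below)))

  involution-admissible : Admissible (just ∘ σ) (λ _ → X)
  involution-admissible = record
    { symmetric   = λ {r} eq → cong just (≡.trans (cong σ (≡.sym (just-injective eq))) (σ-involutive r))
    ; irreflexive = σ-fixpointFree _ ∘ just-injective
    ; matched-X   = λ _ → refl }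

  charPoly-permutationMatrix : (P : Matrix m) → (∀ r c → P r c ≡ permutationMatrix σ r c) →
    charPoly P ≈ (X-1 ^P (m / 2)) *P (X+1 ^P (m / 2))
  charPoly-permutationMatrix P P≡ = begin
    charPoly P                                ≈⟨ det-cong entries ⟩
    det (pairingMatrix (just ∘ σ) (λ _ → X))  ≈⟨ det-pairingMatrix involution-admissible ⟩
    ∏ (λ r → pairedFactor r (σ r))            ≈⟨ ∏-pairedFactor ⟩
    (X-1 ^P (m / 2)) *P (X+1 ^P (m / 2))      ∎
    where
    entries : ∀ i j → ((if ⌊ i ≟ᶠ j ⌋ then X else []) +P constP (- P i j))
                      ≈ pairingMatrix (just ∘ σ) (λ _ → X) i j
    entries i j = +P-cong
      (≡⇒≈ (cong (if_then X else []) (isYes≗does (i ≟ᶠ j))))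
      (≈-trans (≡⇒≈ (cong (λ z → constP (- z)) (≡.trans (P≡ i j) (cong boolℤ (isYes≗does (σ i ≟ᶠ j))))))
               (constP-neg-boolℤ (does (σ i ≟ᶠ j))))

lemma3p6 : (n : ℕ) → 3 ≤ n →
    ((u v : Fin (numV n)) →
      (adjMatrix (adjLCr n) ⊗ distMatrix (adjLCr n) 3) u v
        ≡ (distMatrix (adjLCr n) 3 ⊗ adjMatrix (adjLCr n)) u v)
    × (charPoly (distMatrix (adjLCr n) 3)
        ≈P (((X +P constP (- (+ 1))) ^P ((n * (n ∸ 1)) / 2))
             *P ((X +P constP (+ 1)) ^P ((n * (n ∸ 1)) / 2))))
lemma3p6 (suc (suc (suc k))) (s≤s (s≤s (s≤s _))) =
    adjMatrix-distMatrix-3-comm third-index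
  , coeff-≡ (charPoly-permutationMatrix transpose transpose-involutive transpose-fixpointFree
                                        (distMatrix adj 3) (distMatrix-3 third-index))
  where open LineCrown (suc (suc k))
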